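{- Let $I=(n,m,X_1,\ldots,X_m,\tau_0)$ be an instance in which every $X_j\subseteq[n]$ is a set of consecutive integers, and suppose $I$ is a YES-instance of V2-WPPSG, i.e., there exist $\tau_1,\ldots,\tau_m\in\mathcal{S}_n$ with $\tau_m=\mathrm{id}$ and $\tau_{j-1}\xrightarrow{X_j}\tau_j$ for all $j\in[m]$. Then the sorting strategy is successful on $I$: the permutation $\tau_m$ it produces equals $\mathrm{id}=(1,\ldots,n)$.
   Context: $[n]=\{1,\ldots,n\}$; $\mathcal{S}_n$ is the symmetric group on $[n]$, the image of $i$ under $\tau$ is $i\tau$, and $\tau$ is identified with $(1\tau,\ldots,n\tau)$. For $X\subseteq[n]$, $\tau'\xrightarrow{X}\tau$ means $i\tau=i\tau'$ for all $i\in[n]\setminus X$; $\tau$ is $X$-sorted if $i\tau<j\tau$ for all $i<j$ in $X$ (each $\xrightarrow{X}$-class has exactly one $X$-sorted member). The sorting strategy applied to $\tau_0$ and $X_1,\ldots,X_m$ defines, for $j=1,\ldots,m$, $\tau_j$ as the unique $X_j$-sorted permutation coinciding with $\tau_{j-1}$ outside $X_j$; it is successful if the final $\tau_m$ is the identity. -}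

module Defs where

open import Data.Nat using (ℕ; suc)
open import Data.Fin using (Fin; zero; suc; inject₁; fromℕ; _<_; _≤_)
open import Data.Fin.Subset using (Subset; _∈_; _∉_)
open import Data.Fin.Permutation using (Permutation′; _⟨$⟩ʳ_)
open import Data.Product using (Σ; _×_)
open import Relation.Binary.PropositionalEquality using (_≡_)

-- permutations of [n] (elements of [n] are Fin n, i.e. 0-based)
Perm : ℕ → Set
Perm n = Permutation′ n

img : ∀ {n} → Perm n → Fin n → Fin n
img τ i = τ ⟨$⟩ʳ i

_⟶[_]_ : ∀ {n} → Perm n → Subset n → Perm n → Set
τ' ⟶[ X ] τ = ∀ i → i ∉ X → img τ' i ≡ img τ i

Sorted : ∀ {n} → Subset n → Perm n → Set
Sorted X τ = ∀ i j → i ∈ X → j ∈ X → i < j → img τ i < img τ j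

IsId : ∀ {n} → Perm n → Set
IsId τ = ∀ i → img τ i ≡ i

SamePerm : ∀ {n} → Perm n → Perm n → Set
SamePerm τ τ' = ∀ i → img τ i ≡ img τ' i

Consecutive : ∀ {n} → Subset n → Set
Consecutive X = ∀ i j k → i ∈ X → k ∈ X → i ≤ j → j ≤ k → j ∈ X

-- A sequence ρ 0, …, ρ m with ρ 0 = τ0 and ρ (j-1) --X_j--> ρ j for all j ∈ [m].
-- X : Fin m → Subset n, where X j stands for X_{j+1}.
Chain : ∀ {n m} → Perm n → (Fin m → Subset n) → (Fin (suc m) → Perm n) → Set
Chain τ0 X ρ = SamePerm (ρ zero) τ0 × (∀ j → ρ (inject₁ j) ⟶[ X j ] ρ (suc j))

YesInstance : ∀ {n m} → Perm n → (Fin m → Subset n) → Set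
YesInstance {m = m} τ0 X =
  Σ (Fin (suc m) → Perm _) λ ρ → Chain τ0 X ρ × IsId (ρ (fromℕ m))

-- ρ is the run of the sorting strategy on τ0, X_1, …, X_m:
-- each ρ j is the (unique) X_j-sorted permutation coinciding with ρ (j-1) outside X_j
SortingRun : ∀ {n m} → Perm n → (Fin m → Subset n) → (Fin (suc m) → Perm n) → Set
SortingRun τ0 X ρ = Chain τ0 X ρ × (∀ j → Sorted (X j) (ρ (suc j)))

Successful : ∀ {n m} → Perm n → (Fin m → Subset n) → Set
Successful {m = m} τ0 X = ∀ ρ → SortingRun τ0 X ρ → IsId (ρ (fromℕ m))

-- Compare permutations by the order σ ⊒ π: for all k and p, at least as many of the first p
-- entries of σ are smaller than k as of π. If the positions changed in a step form a window
-- [l, r), then sorting the window of σ moves its small entries as far left as possible, so any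
-- rearrangement of the same window of π stays below it: ⊒ is preserved. The sorting run and the
-- witness chain start from the same permutation, so at the end the run dominates the identity,
-- and the identity is the only permutation that does.
module Submission where

open import Defs
open import Data.Bool using (Bool; true; false; T; T?)
open import Data.Empty using (⊥; ⊥-elim)
open import Data.Fin as Fin using (Fin; zero; suc; toℕ; fromℕ; fromℕ<; inject₁)
open import Data.Fin.Induction using (<-weakInduction; <-wellFounded)
open import Data.Fin.Properties
  using (toℕ-injective; toℕ<n; toℕ-fromℕ<; toℕ-inject; any?; ¬∀⟶∃¬-smallest)
import Data.Fin.Properties as Finₚ
open import Data.Fin.Subset using (Subset; _∈_; _∉_)
open import Data.Fin.Subset.Properties using (_∈?_)
open import Data.Nat
  using (ℕ; zero; suc; _+_; _≤_; _<_; _<ᵇ_; z≤n; s≤s; s≤s⁻¹; _≤′_; ≤′-refl; ≤′-step)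
open import Data.Nat.Properties
open import Algebra.Properties.CommutativeMonoid.Sum +-0-commutativeMonoid using (sum; sum-permute)
open import Algebra.Properties.CommutativeSemigroup +-commutativeSemigroup using (x∙yz≈y∙xz)
open import Data.Product using (∃; ∃₂; _×_; _,_; proj₁; proj₂)
open import Data.Sum using (_⊎_; inj₁; inj₂; [_,_]′)
open import Function using (_⇔_; mk⇔; Equivalence; Injection)
open import Function.Definitions using (Injective)
open import Function.Properties.Inverse using (↔⇒↣)
open import Induction.WellFounded using (Acc; acc)
open import Relation.Binary.PropositionalEquality
open import Relation.Nullary using (¬_; Dec; yes; no; contradiction)
open import Relation.Nullary.Decidable using (decidable-stable; ¬?; _×-dec_)

open Equivalence using (to; from)

bit : Bool → ℕ
bit false = 0
bit true  = 1

count : (ℕ → Bool) → ℕ → ℕ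
count f zero    = zero
count f (suc p) = bit (f p) + count f p

bit-mono : ∀ {b c} → (T b → T c) → bit b ≤ bit c
bit-mono {false}        _ = z≤n
bit-mono {true} {true}  _ = ≤-refl
bit-mono {true} {false} h = ⊥-elim (h _)

bit-false : ∀ {b} → ¬ T b → bit b ≡ 0
bit-false {false} _ = refl
bit-false {true}  h = ⊥-elim (h _)

count≤length : ∀ f p → count f p ≤ p
count≤length f zero    = z≤n
count≤length f (suc p) = +-mono-≤ (bit-mono {c = true} _) (count≤length f p)

count-all-true : ∀ {f p} → (∀ i → i < p → T (f i)) → count f p ≡ p
count-all-true {p = zero} _ = refl
count-all-true {f} {suc p} all with f p | all p (n<1+n p)
... | true | _ = cong suc (count-all-true (λ i i<p → all i (m<n⇒m<1+n i<p)))

count-mono : ∀ {f q p} → q ≤ p → count f q ≤ count f p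
count-mono {f} q≤p = go (≤⇒≤′ q≤p)
  where
  go : ∀ {q p} → q ≤′ p → count f q ≤ count f p
  go ≤′-refl          = ≤-refl
  go (≤′-step {p} q≤p) = ≤-trans (go q≤p) (m≤n+m (count f p) (bit (f p)))

count-mono-from : ∀ {f g q p} → q ≤ p → count f q ≤ count g q →
                  (∀ i → q ≤ i → i < p → T (f i) → T (g i)) → count f p ≤ count g p
count-mono-from {f} {g} {q} q≤p start = go (≤⇒≤′ q≤p)
  where
  go : ∀ {p} → q ≤′ p → (∀ i → q ≤ i → i < p → T (f i) → T (g i)) → count f p ≤ count g p
  go ≤′-refl           _     = start
  go (≤′-step {p} q≤p) f⇒g =
    +-mono-≤ (bit-mono (f⇒g p (≤′⇒≤ q≤p) (n<1+n p)))
             (go q≤p (λ i q≤i i<p → f⇒g i q≤i (m<n⇒m<1+n i<p)))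

count-cong-from : ∀ {f g q p} → q ≤ p → count f q ≡ count g q →
                  (∀ i → q ≤ i → i < p → f i ≡ g i) → count f p ≡ count g p
count-cong-from q≤p start agree = ≤-antisym
  (count-mono-from q≤p (≤-reflexive start) (λ i q≤i i<p → subst T (agree i q≤i i<p)))
  (count-mono-from q≤p (≤-reflexive (sym start)) (λ i q≤i i<p → subst T (sym (agree i q≤i i<p))))

count-cong-downto : ∀ {f g q p} → q ≤ p → count f p ≡ count g p →
                    (∀ i → q ≤ i → i < p → f i ≡ g i) → count f q ≡ count g q
count-cong-downto {f} {g} {q} q≤p = go (≤⇒≤′ q≤p)
  where
  go : ∀ {p} → q ≤′ p → count f p ≡ count g p →
       (∀ i → q ≤ i → i < p → f i ≡ g i) → count f q ≡ count g q
  go ≤′-refl           end _     = end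
  go (≤′-step {p} q≤p) end agree = go q≤p
    (+-cancelˡ-≡ (bit (f p)) _ _
      (trans end (cong (λ b → bit b + count g p) (sym (agree p (≤′⇒≤ q≤p) (n<1+n p))))))
    (λ i q≤i i<p → agree i q≤i (m<n⇒m<1+n i<p))

count-false-from : ∀ {f q p} → q ≤ p → (∀ i → q ≤ i → i < p → ¬ T (f i)) → count f p ≡ count f q
count-false-from {f} {q} q≤p = go (≤⇒≤′ q≤p)
  where
  go : ∀ {p} → q ≤′ p → (∀ i → q ≤ i → i < p → ¬ T (f i)) → count f p ≡ count f q
  go ≤′-refl           _     = refl
  go (≤′-step {p} q≤p) ¬f = trans
    (cong (_+ count f p) (bit-false (¬f p (≤′⇒≤ q≤p) (n<1+n p))))
    (go q≤p (λ i q≤i i<p → ¬f i q≤i (m<n⇒m<1+n i<p)))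

count-shift : ∀ f p → count f (suc p) ≡ bit (f 0) + count (λ i → f (suc i)) p
count-shift f zero    = refl
count-shift f (suc p) =
  trans (cong (bit (f (suc p)) +_) (count-shift f p)) (x∙yz≈y∙xz (bit (f (suc p))) (bit (f 0)) _)

_≼_ : (ℕ → Bool) → (ℕ → Bool) → Set
t ≼ s = ∀ p → count t p ≤ count s p

count-unchanged-outside : ∀ {f f′ l r p} → (∀ i → i < l ⊎ r ≤ i → f′ i ≡ f i) →
                          count f′ r ≡ count f r → p ≤ l ⊎ r ≤ p → count f′ p ≡ count f p
count-unchanged-outside agree _ (inj₁ p≤l) =
  count-cong-from z≤n refl (λ i _ i<p → agree i (inj₁ (<-≤-trans i<p p≤l)))
count-unchanged-outside agree at-r (inj₂ r≤p) =
  count-cong-from r≤p at-r (λ i r≤i _ → agree i (inj₂ r≤i))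

window-dominance : ∀ {l r} {s s′ t t′ : ℕ → Bool} →
  (∀ i → i < l ⊎ r ≤ i → s′ i ≡ s i) → (∀ i → i < l ⊎ r ≤ i → t′ i ≡ t i) →
  count s′ r ≡ count s r → count t′ r ≡ count t r →
  (∀ i j → l ≤ i → i < j → j < r → T (s′ j) → T (s′ i)) →
  t ≼ s → t′ ≼ s′
window-dominance {l} {r} {s} {s′} {t} {t′} s′≈s t′≈t s′-r t′-r sorted t≼s p =
  by-position (p ≤? l) (r ≤? p)
  where
  open ≤-Reasoning

  unchanged : ∀ {q} → q ≤ l ⊎ r ≤ q → count t′ q ≤ count s′ q
  unchanged {q} out = begin
    count t′ q ≡⟨ count-unchanged-outside t′≈t t′-r out ⟩
    count t q  ≤⟨ t≼s q ⟩
    count s q  ≡⟨ count-unchanged-outside s′≈s s′-r out ⟨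
    count s′ q ∎

  -- By sortedness, s′ is true on [l, q] if s′ q holds, and false on (q, r) otherwise.
  inside : ∀ {q} → l < q → q < r → count t′ q ≤ count s′ q
  inside {suc q} (s≤s l≤q) 1+q<r with T? (s′ q)
  ... | yes s′q =
    count-mono-from (m≤n⇒m≤1+n l≤q) (unchanged (inj₁ ≤-refl)) (λ i l≤i i≤q _ → true-below i l≤i i≤q)
    where
    true-below : ∀ i → l ≤ i → i < suc q → T (s′ i)
    true-below i l≤i i<1+q with m<1+n⇒m<n∨m≡n i<1+q
    ... | inj₁ i<q  = sorted i q l≤i i<q (<-trans (n<1+n q) 1+q<r) s′q
    ... | inj₂ refl = s′q
  ... | no ¬s′q = begin
    count t′ (suc q) ≤⟨ count-mono (<⇒≤ 1+q<r) ⟩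
    count t′ r       ≡⟨ t′-r ⟩
    count t r        ≤⟨ t≼s r ⟩
    count s r        ≡⟨ s′-r ⟨
    count s′ r       ≡⟨ count-false-from (<⇒≤ 1+q<r) false-above ⟩
    count s′ (suc q) ∎
    where
    false-above : ∀ i → suc q ≤ i → i < r → ¬ T (s′ i)
    false-above i q<i i<r s′i = ¬s′q (sorted q i l≤q q<i i<r s′i)

  by-position : Dec (p ≤ l) → Dec (r ≤ p) → count t′ p ≤ count s′ p
  by-position (yes p≤l) _         = unchanged (inj₁ p≤l)
  by-position (no _)    (yes r≤p) = unchanged (inj₂ r≤p)
  by-position (no p≰l)  (no r≰p)  = inside (≰⇒> p≰l) (≰⇒> r≰p)

Interval : ∀ {n} → Subset n → ℕ → ℕ → Set
Interval X l r = ∀ i → i ∈ X ⇔ (l ≤ toℕ i × toℕ i < r)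

smallest : ∀ {n} {P : Fin n → Set} → (∀ i → Dec (P i)) → ∃ P →
           ∃ λ i → P i × (∀ j → toℕ j < toℕ i → ¬ P j)
smallest {n} {P} P? (x , Px)
  with ¬∀⟶∃¬-smallest n (λ i → ¬ P i) (λ i → ¬? (P? i)) (λ ¬P → ¬P x Px)
... | i , ¬¬Pi , before = i , decidable-stable (P? i) ¬¬Pi , λ j j<i →
  subst (λ k → ¬ P k) (toℕ-injective (trans (toℕ-inject (fromℕ< j<i)) (toℕ-fromℕ< j<i)))
        (before (fromℕ< j<i))

interval-from-bounds : ∀ {n} {X : Subset n} {x r} → x ∈ X → (∀ j → toℕ j < toℕ x → j ∉ X) →
                       (∀ i → i ∈ X → toℕ i < r) → (∀ i → toℕ x < toℕ i → toℕ i < r → i ∈ X) →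
                       Interval X (toℕ x) r
interval-from-bounds {X = X} x∈X x-least below-r fill i = mk⇔
  (λ i∈X → ≮⇒≥ (λ i<x → x-least i i<x i∈X) , below-r i i∈X)
  (λ (x≤i , i<r) → [ (λ x<i → fill i x<i i<r) , (λ x≡i → subst (_∈ X) (toℕ-injective x≡i) x∈X) ]′
                     (m≤n⇒m<n∨m≡n x≤i))

-- The window ends at the first gap after its least element x, or at n if there is none.
interval-from-least : ∀ {n} {X : Subset n} {x} → Consecutive X →
                      x ∈ X → (∀ j → toℕ j < toℕ x → j ∉ X) → ∃ λ r → r ≤ n × Interval X (toℕ x) r
interval-from-least {n} {X} {x} consecutive x∈X x-least = by-gap (any? gap?)
  where
  gap? : ∀ i → Dec (toℕ x < toℕ i × i ∉ X)
  gap? i = (toℕ x <? toℕ i) ×-dec ¬? (i ∈? X)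

  by-gap : Dec (∃ λ i → toℕ x < toℕ i × i ∉ X) → ∃ λ r → r ≤ n × Interval X (toℕ x) r
  by-gap (no no-gap) = n , ≤-refl , interval-from-bounds x∈X x-least (λ i _ → toℕ<n i)
    (λ i x<i _ → decidable-stable (i ∈? X) (λ i∉X → no-gap (i , x<i , i∉X)))
  by-gap (yes some-gap) with smallest gap? some-gap
  ... | y , (x<y , y∉X) , y-first = toℕ y , <⇒≤ (toℕ<n y) , interval-from-bounds x∈X x-least
    (λ i i∈X → ≰⇒> (λ y≤i → y∉X (consecutive x y i x∈X i∈X (<⇒≤ x<y) y≤i)))
    (λ i x<i i<y → decidable-stable (i ∈? X) (λ i∉X → y-first i i<y (x<i , i∉X)))

consecutive⇒interval : ∀ {n} {X : Subset n} → Consecutive X → ∃₂ λ l r → r ≤ n × Interval X l r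
consecutive⇒interval {n} {X} consecutive with any? (_∈? X)
... | no empty =
  0 , 0 , z≤n , λ i → mk⇔ (λ i∈X → contradiction (i , i∈X) empty) (λ { (_ , ()) })
... | yes nonempty with smallest (_∈? X) nonempty
...   | x , x∈X , x-least = toℕ x , interval-from-least consecutive x∈X x-least

extend : ∀ {n} → (Fin n → Bool) → ℕ → Bool
extend {zero}  g _       = false
extend {suc n} g zero    = g zero
extend {suc n} g (suc i) = extend (λ x → g (suc x)) i

extend-toℕ : ∀ {n} (g : Fin n → Bool) x → extend g (toℕ x) ≡ g x
extend-toℕ g zero    = refl
extend-toℕ g (suc x) = extend-toℕ (λ y → g (suc y)) x

extend-fromℕ< : ∀ {n} (g : Fin n → Bool) {i} (i<n : i < n) → extend g i ≡ g (fromℕ< i<n)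
extend-fromℕ< {suc n} g {zero}  _          = refl
extend-fromℕ< {suc n} g {suc i} (s≤s i<n) = extend-fromℕ< (λ x → g (suc x)) i<n

extend-cong : ∀ {n} {g h : Fin n → Bool} i → (∀ x → toℕ x ≡ i → g x ≡ h x) →
              extend g i ≡ extend h i
extend-cong {zero}  i       _     = refl
extend-cong {suc n} zero    agree = agree zero refl
extend-cong {suc n} (suc i) agree = extend-cong i (λ x x≡i → agree (suc x) (cong suc x≡i))

extend-true⇒< : ∀ {n} {g : Fin n → Bool} i → T (extend g i) → i < n
extend-true⇒< {suc n} zero    _ = s≤s z≤n
extend-true⇒< {suc n} (suc i) t = s≤s (extend-true⇒< i t)

count-extend : ∀ {n} (g : Fin n → Bool) → count (extend g) n ≡ sum (λ x → bit (g x))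
count-extend {zero}  g = refl
count-extend {suc n} g =
  trans (count-shift (extend g) n) (cong (bit (g zero) +_) (count-extend (λ x → g (suc x))))

below : ∀ {n} → ℕ → Perm n → ℕ → Bool
below k τ = extend (λ x → toℕ (img τ x) <ᵇ k)

T-below : ∀ {n} k (τ : Perm n) {i} (i<n : i < n) → T (below k τ i) ⇔ toℕ (img τ (fromℕ< i<n)) < k
T-below k τ i<n = mk⇔
  (λ t → <ᵇ⇒< _ k (subst T (extend-fromℕ< _ i<n) t))
  (λ lt → subst T (sym (extend-fromℕ< _ i<n)) (<⇒<ᵇ lt))

count-below-total : ∀ {n} k (σ π : Perm n) → count (below k σ) n ≡ count (below k π) n
count-below-total {n} k σ π = begin
  count (below k σ) n                   ≡⟨ count-extend (λ x → toℕ (img σ x) <ᵇ k) ⟩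
  sum (λ x → small (img σ x))           ≡⟨ sum-permute small σ ⟨
  sum small                             ≡⟨ sum-permute small π ⟩
  sum (λ x → small (img π x))           ≡⟨ count-extend (λ x → toℕ (img π x) <ᵇ k) ⟨
  count (below k π) n                   ∎
  where
  open ≡-Reasoning
  small : Fin n → ℕ
  small y = bit (toℕ y <ᵇ k)

record _⊒_ {n} (σ π : Perm n) : Set where
  constructor dominance
  field dominates : ∀ k → below k π ≼ below k σ

open _⊒_

⊒-same : ∀ {n} {σ π : Perm n} → SamePerm σ π → σ ⊒ π
⊒-same same = dominance λ k p → ≤-reflexive (count-cong-from {p = p} z≤n refl
  (λ i _ _ → extend-cong i (λ x _ → cong (λ y → toℕ y <ᵇ k) (sym (same x)))))

⊒-step : ∀ {n} {X : Subset n} {l r} {σ σ′ π π′ : Perm n} →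
  r ≤ n → Interval X l r → σ ⟶[ X ] σ′ → π ⟶[ X ] π′ → Sorted X σ′ → σ ⊒ π → σ′ ⊒ π′
⊒-step {n} {X} {l} {r} {σ} {σ′} {π} {π′} r≤n window σ⟶σ′ π⟶π′ σ′-sorted σ⊒π = dominance λ k →
  window-dominance {l} {r} (unchanged k {σ} {σ′} σ⟶σ′) (unchanged k {π} {π′} π⟶π′)
    (window-total k {σ} {σ′} σ⟶σ′) (window-total k {π} {π′} π⟶π′) (sorted k) (dominates σ⊒π k)
  where
  outside∉ : ∀ x → toℕ x < l ⊎ r ≤ toℕ x → x ∉ X
  outside∉ x (inj₁ x<l) x∈X = <⇒≱ x<l (proj₁ (to (window x) x∈X))
  outside∉ x (inj₂ r≤x) x∈X = <⇒≱ (proj₂ (to (window x) x∈X)) r≤x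

  unchanged : ∀ k {τ τ′} → τ ⟶[ X ] τ′ → ∀ i → i < l ⊎ r ≤ i → below k τ′ i ≡ below k τ i
  unchanged k τ⟶τ′ i out = extend-cong i λ x x≡i →
    cong (λ y → toℕ y <ᵇ k) (sym (τ⟶τ′ x (outside∉ x (subst (λ j → j < l ⊎ r ≤ j) (sym x≡i) out))))

  window-total : ∀ k {τ τ′} → τ ⟶[ X ] τ′ → count (below k τ′) r ≡ count (below k τ) r
  window-total k {τ} {τ′} τ⟶τ′ = count-cong-downto r≤n (count-below-total k τ′ τ)
    (λ i r≤i _ → unchanged k {τ} {τ′} τ⟶τ′ i (inj₂ r≤i))

  in-window : ∀ {i} (i<n : i < n) → l ≤ i → i < r → fromℕ< i<n ∈ X
  in-window i<n l≤i i<r = from (window (fromℕ< i<n))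
    (subst (l ≤_) (sym (toℕ-fromℕ< i<n)) l≤i , subst (_< r) (sym (toℕ-fromℕ< i<n)) i<r)

  sorted : ∀ k i j → l ≤ i → i < j → j < r → T (below k σ′ j) → T (below k σ′ i)
  sorted k i j l≤i i<j j<r σ′j<k =
    from (T-below k σ′ i<n) (<-trans σ′i<σ′j (to (T-below k σ′ j<n) σ′j<k))
    where
    j<n = extend-true⇒< j σ′j<k
    i<n = <-trans i<j j<n
    σ′i<σ′j = σ′-sorted (fromℕ< i<n) (fromℕ< j<n) (in-window i<n l≤i (<-trans i<j j<r))
      (in-window j<n (<⇒≤ (≤-<-trans l≤i i<j)) j<r)
      (subst₂ _<_ (sym (toℕ-fromℕ< i<n)) (sym (toℕ-fromℕ< j<n)) i<j)

decreasing-injection-id : ∀ {n} (f : Fin n → Fin n) → Injective _≡_ _≡_ f →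
                          (∀ i → f i Fin.≤ i) → ∀ i → f i ≡ i
decreasing-injection-id f injective decreasing i = go i (<-wellFounded i)
  where
  go : ∀ i → Acc Fin._<_ i → f i ≡ i
  go i (acc smaller) with f i Fin.≟ i
  ... | yes fi≡i = fi≡i
  ... | no fi≢i  =
    contradiction (injective (go (f i) (smaller (Finₚ.≤∧≢⇒< (decreasing i) fi≢i)))) fi≢i

-- Entry j of σ cannot exceed j: among the first j + 1 positions π holds j + 1 entries ≤ j,
-- while σ holds at most j.
⊒-identity : ∀ {n} {σ π : Perm n} → IsId π → σ ⊒ π → IsId σ
⊒-identity {n} {σ} {π} π-id σ⊒π =
  decreasing-injection-id (img σ) (Injection.injective (↔⇒↣ σ)) (λ j → ≮⇒≥ (entry-not-above j))
  where
  entry-not-above : ∀ j → toℕ j < toℕ (img σ j) → ⊥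
  entry-not-above j j<σj = 1+n≰n (begin
    suc (toℕ j)                   ≡⟨ count-all-true π-small ⟨
    count (below k π) (suc (toℕ j)) ≤⟨ dominates σ⊒π k (suc (toℕ j)) ⟩
    count (below k σ) (suc (toℕ j)) ≡⟨ cong (_+ count (below k σ) (toℕ j)) (bit-false σ-large) ⟩
    count (below k σ) (toℕ j)       ≤⟨ count≤length (below k σ) (toℕ j) ⟩
    toℕ j                         ∎)
    where
    open ≤-Reasoning
    k : ℕ
    k = suc (toℕ j)

    π-small : ∀ i → i < k → T (below k π i)
    π-small i i<k = from (T-below k π i<n)
      (subst (_< k) (sym (trans (cong toℕ (π-id _)) (toℕ-fromℕ< i<n))) i<k)
      where i<n = <-≤-trans i<k (toℕ<n j)

    σ-large : ¬ T (below k σ (toℕ j))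
    σ-large σj<k = <⇒≱ j<σj (s≤s⁻¹ (<ᵇ⇒< _ k (subst T (extend-toℕ _ j) σj<k)))

theorem3p12 : (n m : ℕ) (X : Fin m → Subset n) (τ0 : Perm n) →
    (∀ j → Consecutive (X j)) → YesInstance τ0 X → Successful τ0 X
theorem3p12 n m X τ0 consecutive (ρ , (ρ₀≈τ0 , ρ-chain) , ρ-final-id)
            σ ((σ₀≈τ0 , σ-chain) , σ-sorted) =
  ⊒-identity ρ-final-id (<-weakInduction (λ j → σ j ⊒ ρ j) start step (fromℕ m))
  where
  start : σ zero ⊒ ρ zero
  start = ⊒-same (λ i → trans (σ₀≈τ0 i) (sym (ρ₀≈τ0 i)))

  step : ∀ j → σ (inject₁ j) ⊒ ρ (inject₁ j) → σ (suc j) ⊒ ρ (suc j)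
  step j with consecutive⇒interval (consecutive j)
  ... | l , r , r≤n , window = ⊒-step r≤n window (σ-chain j) (ρ-chain j) (σ-sorted j)
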